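{- Let $\mathcal{D}$ be an open coderivation. Then $[\![\mathcal{D}]\!] = \bigcup_{\mathcal{D}'\in F(\mathcal{D})}[\![\mathcal{D}']\!]$, where $F(\mathcal{D})$ is the set of finite approximations of $\mathcal{D}$.
   Context: Formulas are those of propositional MELL with units ($A,B ::= X \mid X^\perp \mid A\otimes B \mid A ⅋ B \mid {!A} \mid {?A} \mid \mathbf{1} \mid \bot$, $⅋$ being "par"). Open coderivations are coderivations (possibly infinite binary trees labeled by sequents, taken as finite sequences with an exchange rule, locally rule instances) over axiom, cut, $⅋$, $\otimes$, $\mathbf{1}$, $\bot$, weakening $?\mathsf{w}$, absorption $?\mathsf{b}$ (from $\Gamma,A,?A$ infer $\Gamma,?A$), conditional promotion $\mathsf{cp}$ (from left premise $\Gamma,A$ and right premise $?\Gamma,!A$ infer $?\Gamma,!A$) and the premise-free rule $\mathsf{hyp}$. A finite approximation of $\mathcal{D}$ is a finite open coderivation obtained from $\mathcal{D}$ by replacing sub-coderivations at a set of pairwise incomparable nodes by $\mathsf{hyp}$. Relational semantics: $[\![X]\!]$ an arbitrary set, $[\![\mathbf{1}]\!]=\{*\}$, $[\![A\otimes B]\!]=[\![A]\!]\times[\![B]\!]$, $[\![!A]\!]$ the finite multisets over $[\![A]\!]$, $[\![A^\perp]\!]=[\![A]\!]$; a sequent $A_1,\dots,A_n$ is interpreted as $[\![A_1⅋\cdots⅋A_n]\!]$. For $\mathcal{D}$ with conclusion $\Gamma$, $[\![\mathcal{D}]\!]=\bigcup_n[\![\mathcal{D}]\!]_n$ where $[\![\mathcal{D}]\!]_0=\emptyset$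 and $[\![\mathcal{D}]\!]_n$ ($n>0$) is computed from the $(n-1)$-th interpretations of the immediate sub-coderivations: axiom gives $\{(x,x)\}$; cut gives $\{(\vec x,\vec y)\mid \exists z,\ (\vec x,z)\in[\![\mathcal{D}']\!]_{n-1},(z,\vec y)\in[\![\mathcal{D}'']\!]_{n-1}\}$; $⅋$, $\otimes$, $\bot$, $\mathbf{1}$ are the usual tupling; $\mathsf{hyp}$ gives $\emptyset$; $?\mathsf{w}$ gives $\{(\vec x,[\,])\}$; $?\mathsf{b}$ gives $\{(\vec x,[y]+\mu)\mid(\vec x,y,\mu)\in[\![\mathcal{D}']\!]_{n-1}\}$; $\mathsf{cp}$ gives $\{([\,],\dots,[\,],[\,])\}\cup\{([x_1]+\mu_1,\dots,[x_k]+\mu_k,[x]+\mu)\mid (x_1,\dots,x_k,x)\in[\![\mathcal{D}']\!]_{n-1},(\mu_1,\dots,\mu_k,\mu)\in[\![\mathcal{D}'']\!]_{n-1}\}$. -}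

module Defs where

open import Data.Nat using (ℕ; zero; suc)
open import Data.Fin using (Fin; toℕ)
open import Data.Unit using (⊤; tt)
open import Data.Empty using (⊥)
open import Data.Product using (Σ; _×_; _,_; ∃; ∃-syntax)
open import Data.List using (List; []; _∷_; _++_; map; length; lookup)
open import Data.List.Relation.Unary.All using (All; []; _∷_)
open import Data.List.Relation.Unary.All.Properties using (++⁺)
open import Data.List.Relation.Binary.Permutation.Propositional using (_↭_)
open import Data.List.Relation.Binary.Permutation.Propositional.Properties using (All-resp-↭)
open import Data.List.Relation.Binary.Permutation.Homogeneous using (Permutation)
open import Relation.Binary.PropositionalEquality using (_≡_; subst; sym)

infixr 6 _⊗_ _⅋_

data Fm : Set where
  var  : ℕ → Fm
  nvar : ℕ → Fm
  _⊗_  : Fm → Fm → Fm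
  _⅋_  : Fm → Fm → Fm
  !_   : Fm → Fm
  ¿_   : Fm → Fm
  𝟏    : Fm
  ⊥ᶠ   : Fm

dual : Fm → Fm
dual (var n)  = nvar n
dual (nvar n) = var n
dual (A ⊗ B)  = dual A ⅋ dual B
dual (A ⅋ B)  = dual A ⊗ dual B
dual (! A)    = ¿ dual A
dual (¿ A)    = ! dual A
dual 𝟏        = ⊥ᶠ
dual ⊥ᶠ       = 𝟏

-- sequents: finite sequences of formulas.  The principal formula of a
-- rule is written first:  "Γ , A"  is represented by  A ∷ Γ.
Seq : Set
Seq = List Fm

data Rule : Seq → Set where
  ax   : (A : Fm) → Rule (dual A ∷ A ∷ [])
  cut  : (A : Fm) (Γ Δ : Seq) → Rule (Γ ++ Δ)
  par  : (A B : Fm) (Γ : Seq) → Rule ((A ⅋ B) ∷ Γ)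
  ten  : (A B : Fm) (Γ Δ : Seq) → Rule ((A ⊗ B) ∷ (Γ ++ Δ))
  one  : Rule (𝟏 ∷ [])
  bot  : (Γ : Seq) → Rule (⊥ᶠ ∷ Γ)
  wk   : (A : Fm) (Γ : Seq) → Rule (¿ A ∷ Γ)
  abs  : (A : Fm) (Γ : Seq) → Rule (¿ A ∷ Γ)
  cp   : (A : Fm) (Γ : Seq) → Rule (! A ∷ map ¿_ Γ)
  hyp  : (Γ : Seq) → Rule Γ
  exch : (Γ Δ : Seq) → Γ ↭ Δ → Rule Δ

prems : ∀ {Γ} → Rule Γ → List Seq
prems (ax A)        = []
prems (cut A Γ Δ)   = (A ∷ Γ) ∷ (dual A ∷ Δ) ∷ []
prems (par A B Γ)   = (A ∷ B ∷ Γ) ∷ []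
prems (ten A B Γ Δ) = (A ∷ Γ) ∷ (B ∷ Δ) ∷ []
prems one           = []
prems (bot Γ)       = Γ ∷ []
prems (wk A Γ)      = Γ ∷ []
prems (abs A Γ)     = (A ∷ ¿ A ∷ Γ) ∷ []
prems (cp A Γ)      = (A ∷ Γ) ∷ (! A ∷ map ¿_ Γ) ∷ []
prems (hyp Γ)       = []
prems (exch Γ Δ π)  = Γ ∷ []

IsHyp : ∀ {Γ} → Rule Γ → Set
IsHyp (hyp _) = ⊤
IsHyp _       = ⊥

-- Open coderivations: possibly infinite trees, given as labellings of
-- addresses.  An address is the (reversed) path from the root: the
-- i-th premise of the node at p is at  i ∷ p.

Addr : Set
Addr = List ℕ

record Coder (Γ : Seq) : Set where
  field
    conc : Addr → Seq
    rule : (p : Addr) → Rule (conc p)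
    root : conc [] ≡ Γ
    coh  : (p : Addr) (i : Fin (length (prems (rule p)))) →
           conc (toℕ i ∷ p) ≡ lookup (prems (rule p)) i
open Coder public

-- D′ ⊑ D: D′ is obtained from D by replacing
-- the sub-coderivations at some pairwise incomparable nodes by hyp,
-- and the result is finite (the relation is inductive, hence every
-- branch of D′ ends in a leaf after finitely many steps).

data Approx {Γ : Seq} (D′ D : Coder Γ) : Addr → Set where
  prune : ∀ {p} → conc D′ p ≡ conc D p → IsHyp (rule D′ p) → Approx D′ D p
  keep  : ∀ {p} (e : conc D′ p ≡ conc D p) →
          subst Rule e (rule D′ p) ≡ rule D p →
          ((i : Fin (length (prems (rule D p)))) → Approx D′ D (toℕ i ∷ p)) →
          Approx D′ D p

_⊑_ : ∀ {Γ} → Coder Γ → Coder Γ → Set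
D′ ⊑ D = Approx D′ D []

-- Finite multisets are lists taken up to permutation (w.r.t. the
-- equivalence of their elements); interpretations are sets of
-- equivalence classes, represented as ≈-closed predicates.

module Sem (V : ℕ → Set) where

  ⟦_⟧ : Fm → Set
  ⟦ var n ⟧  = V n
  ⟦ nvar n ⟧ = V n
  ⟦ A ⊗ B ⟧  = ⟦ A ⟧ × ⟦ B ⟧
  ⟦ A ⅋ B ⟧  = ⟦ A ⟧ × ⟦ B ⟧
  ⟦ ! A ⟧    = List ⟦ A ⟧
  ⟦ ¿ A ⟧    = List ⟦ A ⟧
  ⟦ 𝟏 ⟧      = ⊤
  ⟦ ⊥ᶠ ⟧     = ⊤

  Eq : (A : Fm) → ⟦ A ⟧ → ⟦ A ⟧ → Set
  Eq (var n)  x y = x ≡ y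
  Eq (nvar n) x y = x ≡ y
  Eq (A ⊗ B) (a , b) (a′ , b′) = Eq A a a′ × Eq B b b′
  Eq (A ⅋ B) (a , b) (a′ , b′) = Eq A a a′ × Eq B b b′
  Eq (! A) μ ν = Permutation (Eq A) μ ν
  Eq (¿ A) μ ν = Permutation (Eq A) μ ν
  Eq 𝟏  _ _ = ⊤
  Eq ⊥ᶠ _ _ = ⊤

  coe : (A : Fm) → ⟦ A ⟧ → ⟦ dual A ⟧
  coe (var n)  x = x
  coe (nvar n) x = x
  coe (A ⊗ B) (a , b) = coe A a , coe B b
  coe (A ⅋ B) (a , b) = coe A a , coe B b
  coe (! A) μ = map (coe A) μ
  coe (¿ A) μ = map (coe A) μ
  coe 𝟏  x = x
  coe ⊥ᶠ x = x

  -- points of a sequent A₁,…,Aₙ: tuples in [[A₁ ⅋ ⋯ ⅋ Aₙ]]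
  Pt : Seq → Set
  Pt Γ = All ⟦_⟧ Γ

  EqPt : ∀ {Γ} → Pt Γ → Pt Γ → Set
  EqPt {[]}    []       []       = ⊤
  EqPt {A ∷ Γ} (x ∷ xs) (y ∷ ys) = Eq A x y × EqPt xs ys

  Pred : Seq → Set₁
  Pred Γ = Pt Γ → Set

  addAll : ∀ Γ → Pt Γ → Pt (map ¿_ Γ) → Pt (map ¿_ Γ)
  addAll []      []       []       = []
  addAll (A ∷ Γ) (x ∷ xs) (μ ∷ μs) = (x ∷ μ) ∷ addAll Γ xs μs

  empties : ∀ Γ → Pt (map ¿_ Γ)
  empties []      = []
  empties (A ∷ Γ) = [] ∷ empties Γ

  step : ∀ {Γ} (r : Rule Γ) → All Pred (prems r) → Pred Γ
  step (ax A) [] (u ∷ y ∷ []) = u ≡ coe A y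
  step (cut A Γ Δ) (S₁ ∷ S₂ ∷ []) w =
    ∃[ xs ] ∃[ ys ] ∃[ z ] (w ≡ ++⁺ xs ys × S₁ (z ∷ xs) × S₂ (coe A z ∷ ys))
  step (par A B Γ) (S ∷ []) w =
    ∃[ a ] ∃[ b ] ∃[ xs ] (w ≡ (a , b) ∷ xs × S (a ∷ b ∷ xs))
  step (ten A B Γ Δ) (S₁ ∷ S₂ ∷ []) w =
    ∃[ a ] ∃[ b ] ∃[ xs ] ∃[ ys ]
      (w ≡ (a , b) ∷ ++⁺ xs ys × S₁ (a ∷ xs) × S₂ (b ∷ ys))
  step one [] w = w ≡ tt ∷ []
  step (bot Γ) (S ∷ []) w = ∃[ xs ] (w ≡ tt ∷ xs × S xs)
  step (wk A Γ) (S ∷ []) w = ∃[ xs ] (w ≡ [] ∷ xs × S xs)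
  step (abs A Γ) (S ∷ []) w =
    ∃[ y ] ∃[ μ ] ∃[ xs ] (w ≡ (y ∷ μ) ∷ xs × S (y ∷ μ ∷ xs))
  step (cp A Γ) (S₁ ∷ S₂ ∷ []) w =
    (w ≡ [] ∷ empties Γ) Data.Sum.⊎
    (∃[ x ] ∃[ xs ] ∃[ μ ] ∃[ μs ]
      (w ≡ (x ∷ μ) ∷ addAll Γ xs μs × S₁ (x ∷ xs) × S₂ (μ ∷ μs)))
    where import Data.Sum
  step (hyp Γ) [] w = ⊥
  step (exch Γ Δ π) (S ∷ []) w = ∃[ xs ] (w ≡ All-resp-↭ π xs × S xs)

  collect : (ps : List Seq) →
            ((i : Fin (length ps)) → Pred (lookup ps i)) → All Pred ps
  collect []       f = []
  collect (Δ ∷ ps) f = f Fin.zero ∷ collect ps (λ i → f (Fin.suc i))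
    where import Data.Fin as Fin

  -- n-th interpretation of the sub-coderivation at address p
  -- (closed under equality of points)
  semAt : ∀ {Γ} (D : Coder Γ) → ℕ → (p : Addr) → Pred (conc D p)
  semAt D zero    p w = ⊥
  semAt D (suc n) p w =
    ∃[ w′ ] (EqPt w′ w ×
      step (rule D p)
           (collect (prems (rule D p))
              (λ i → subst Pred (coh D p i) (semAt D n (toℕ i ∷ p))))
           w′)

  ⟦_⟧ₙ : ∀ {Γ} → Coder Γ → ℕ → Pred Γ
  ⟦ D ⟧ₙ n = subst Pred (root D) (semAt D n [])

  ⟦_⟧ᴰ : ∀ {Γ} → Coder Γ → Pred Γ
  ⟦ D ⟧ᴰ w = ∃[ n ] ⟦ D ⟧ₙ n w

module Submission where

-- [[D]]ₙ only inspects the nodes of D at depth < n, so it is contained in the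
-- n-th interpretation of the truncation of D at depth n, which is a finite
-- approximation of D.  Conversely, hyp is interpreted by ∅, so the n-th
-- interpretation can only shrink when sub-coderivations are replaced by hyp.

open import Defs
open import Data.Nat using (ℕ; zero; suc; _∸_; _≤_; _<_; z≤n; z<s; pred)
open import Data.Nat.Properties using (pred[m∸n]≡m∸[1+n]; pred-mono-≤; ≤-<-trans; ≤-refl)
open import Data.Fin using (Fin; toℕ) renaming (zero to fzero; suc to fsuc)
open import Data.Product using (_×_; _,_; ∃-syntax)
open import Data.Sum using (inj₁; inj₂)
open import Data.Empty using (⊥-elim)
open import Data.Unit using (tt)
open import Data.List using ([]; _∷_; length; lookup)
open import Data.List.Relation.Unary.All using ([])
open import Relation.Nullary using (¬_)
open import Relation.Binary.PropositionalEquality using (_≡_; refl; sym; trans; subst; cong)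
open import Function.Bundles using (_⇔_; mk⇔)

Coherent : ∀ {Γ} → (ℕ → Seq) → Rule Γ → Set
Coherent c r = (i : Fin (length (prems r))) → c (toℕ i) ≡ lookup (prems r) i

truncRule : ∀ {Γ} → ℕ → Rule Γ → Rule Γ
truncRule zero    r = hyp _
truncRule (suc k) r = r

truncRule-pos : ∀ {Γ k} (r : Rule Γ) → 0 < k → truncRule k r ≡ r
truncRule-pos {k = suc k} r _ = refl

truncRule-coherent : ∀ {Γ} (c : ℕ → Seq) k {r : Rule Γ} → Coherent c r → Coherent c (truncRule k r)
truncRule-coherent c zero    ch ()
truncRule-coherent c (suc k) ch = ch

truncate : ∀ {Γ} → ℕ → Coder Γ → Coder Γ
truncate n D = record
  { conc = conc D
  ; rule = λ p → truncRule (n ∸ length p) (rule D p)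
  ; root = root D
  ; coh  = λ p → truncRule-coherent (λ j → conc D (j ∷ p)) (n ∸ length p) (coh D p)
  }

truncate-⊑ : ∀ {Γ} (D : Coder Γ) n → truncate n D ⊑ D
truncate-⊑ D n = approx n [] refl
  where
  approx : ∀ k p → n ∸ length p ≡ k → Approx (truncate n D) D p
  approx zero p eq =
    prune refl (subst (λ k → IsHyp (truncRule k (rule D p))) (sym eq) tt)
  approx (suc k) p eq =
    keep refl (truncRule-pos (rule D p) (subst (0 <_) (sym eq) z<s)) λ i →
      approx k (toℕ i ∷ p) (trans (sym (pred[m∸n]≡m∸[1+n] n (length p))) (cong pred eq))

module _ (V : ℕ → Set) where
  open Sem V

  _⊆_ : ∀ {Γ} → Pred Γ → Pred Γ → Set
  P ⊆ Q = ∀ w → P w → Q w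

  -- Inclusion across an equality of sequents.  Matching such an equality
  -- against refl relies on K, which is harmless here: Seq has decidable
  -- equality, hence unique identity proofs.
  _≲_ : ∀ {Γ Δ} → Pred Γ → Pred Δ → Set
  _≲_ {Γ} {Δ} P Q = (e : Γ ≡ Δ) → subst Pred e P ⊆ Q

  ≲⇒subst-⊆ : ∀ {Γ Δ Θ} {P : Pred Γ} {Q : Pred Δ} → P ≲ Q →
              (e₁ : Γ ≡ Θ) (e₂ : Δ ≡ Θ) → subst Pred e₁ P ⊆ subst Pred e₂ Q
  ≲⇒subst-⊆ P≲Q e₁ refl = P≲Q e₁

  empty-≲ : ∀ {Γ Δ} {P : Pred Γ} {Q : Pred Δ} → (∀ w → ¬ P w) → P ≲ Q
  empty-≲ P-empty refl w x = ⊥-elim (P-empty w x)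

  step-mono : ∀ {Γ} (r : Rule Γ) (F G : (i : Fin (length (prems r))) → Pred (lookup (prems r) i)) →
              (∀ i → F i ⊆ G i) → step r (collect _ F) ⊆ step r (collect _ G)
  step-mono (ax A)        F G F⊆G w s = s
  step-mono (cut A Γ Δ)   F G F⊆G w (xs , ys , z , e , s₁ , s₂) =
    xs , ys , z , e , F⊆G fzero _ s₁ , F⊆G (fsuc fzero) _ s₂
  step-mono (par A B Γ)   F G F⊆G w (a , b , xs , e , s) = a , b , xs , e , F⊆G fzero _ s
  step-mono (ten A B Γ Δ) F G F⊆G w (a , b , xs , ys , e , s₁ , s₂) =
    a , b , xs , ys , e , F⊆G fzero _ s₁ , F⊆G (fsuc fzero) _ s₂
  step-mono one           F G F⊆G w s = s
  step-mono (bot Γ)       F G F⊆G w (xs , e , s) = xs , e , F⊆G fzero _ s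
  step-mono (wk A Γ)      F G F⊆G w (xs , e , s) = xs , e , F⊆G fzero _ s
  step-mono (abs A Γ)     F G F⊆G w (y , μ , xs , e , s) = y , μ , xs , e , F⊆G fzero _ s
  step-mono (cp A Γ)      F G F⊆G w (inj₁ e) = inj₁ e
  step-mono (cp A Γ)      F G F⊆G w (inj₂ (x , xs , μ , μs , e , s₁ , s₂)) =
    inj₂ (x , xs , μ , μs , e , F⊆G fzero _ s₁ , F⊆G (fsuc fzero) _ s₂)
  step-mono (hyp Γ)       F G F⊆G w ()
  step-mono (exch Γ Δ π)  F G F⊆G w (xs , e , s) = xs , e , F⊆G fzero _ s

  step-hyp-empty : ∀ {Γ} (r : Rule Γ) → IsHyp r → ∀ S w → ¬ step r S w
  step-hyp-empty (hyp Γ) _ [] w ()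

  -- semAt D (suc n) p unfolds to node (rule D p) (λ j → conc D (j ∷ p)) (coh D p) (λ j → semAt D n (j ∷ p)).
  node : ∀ {Γ} (r : Rule Γ) (c : ℕ → Seq) → Coherent c r → ((j : ℕ) → Pred (c j)) → Pred Γ
  node r c ch S w =
    ∃[ w′ ] (EqPt w′ w × step r (collect (prems r) (λ i → subst Pred (ch i) (S (toℕ i)))) w′)

  node-mono : ∀ {Γ′ Γ} (r′ : Rule Γ′) (r : Rule Γ) (e : Γ′ ≡ Γ) → subst Rule e r′ ≡ r →
              (c′ c : ℕ → Seq) (ch′ : Coherent c′ r′) (ch : Coherent c r)
              (S′ : (j : ℕ) → Pred (c′ j)) (S : (j : ℕ) → Pred (c j)) →
              ((i : Fin (length (prems r))) → S′ (toℕ i) ≲ S (toℕ i)) → node r′ c′ ch′ S′ ≲ node r c ch S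
  node-mono r′ .r′ refl refl c′ c ch′ ch S′ S S′≲S refl w (w′ , w′≈w , s) =
    w′ , w′≈w , step-mono r′ _ _ (λ i → ≲⇒subst-⊆ (S′≲S i) (ch′ i) (ch i)) w′ s

  semAt-suc-mono : ∀ {Γ′ Γ} (D′ : Coder Γ′) (D : Coder Γ) {p′ p} m →
                   (e : conc D′ p′ ≡ conc D p) → subst Rule e (rule D′ p′) ≡ rule D p →
                   ((i : Fin (length (prems (rule D p)))) → semAt D′ m (toℕ i ∷ p′) ≲ semAt D m (toℕ i ∷ p)) →
                   semAt D′ (suc m) p′ ≲ semAt D (suc m) p
  semAt-suc-mono D′ D {p′} {p} m e r′≡r =
    node-mono (rule D′ p′) (rule D p) e r′≡r
      (λ j → conc D′ (j ∷ p′)) (λ j → conc D (j ∷ p)) (coh D′ p′) (coh D p)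
      (λ j → semAt D′ m (j ∷ p′)) (λ j → semAt D m (j ∷ p))

  ⊑-semAt : ∀ {Γ} {D′ D : Coder Γ} {p} → Approx D′ D p → ∀ m → semAt D′ m p ≲ semAt D m p
  ⊑-semAt _ zero = empty-≲ λ _ ()
  ⊑-semAt {D′ = D′} {p = p} (prune _ isHyp) (suc m) =
    empty-≲ λ { w (w′ , _ , s) → step-hyp-empty (rule D′ p) isHyp _ w′ s }
  ⊑-semAt {D′ = D′} {D} (keep e r′≡r approx) (suc m) =
    semAt-suc-mono D′ D m e r′≡r λ i → ⊑-semAt (approx i) m

  semAt-truncate : ∀ {Γ} (D : Coder Γ) n m p → m ≤ n ∸ length p →
                   semAt D m p ≲ semAt (truncate n D) m p
  semAt-truncate D n zero    p _   = empty-≲ λ _ ()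
  semAt-truncate D n (suc m) p m<n∸∣p∣ =
    semAt-suc-mono D (truncate n D) m refl
      (sym (truncRule-pos (rule D p) (≤-<-trans z≤n m<n∸∣p∣))) λ i →
        semAt-truncate D n m (toℕ i ∷ p)
          (subst (m ≤_) (pred[m∸n]≡m∸[1+n] n (length p)) (pred-mono-≤ m<n∸∣p∣))

  ⊑⇒⟦⟧ₙ-⊆ : ∀ {Γ} {D′ D : Coder Γ} → D′ ⊑ D → ∀ n → ⟦ D′ ⟧ₙ n ⊆ ⟦ D ⟧ₙ n
  ⊑⇒⟦⟧ₙ-⊆ {D′ = D′} {D} D′⊑D n = ≲⇒subst-⊆ (⊑-semAt D′⊑D n) (root D′) (root D)

  ⟦⟧ₙ-⊆-truncate : ∀ {Γ} (D : Coder Γ) n → ⟦ D ⟧ₙ n ⊆ ⟦ truncate n D ⟧ₙ n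
  ⟦⟧ₙ-⊆-truncate D n = ≲⇒subst-⊆ (semAt-truncate D n n [] ≤-refl) (root D) (root D)

lemma6p3 : (V : ℕ → Set) {Γ : Seq} (D : Coder Γ) (w : Sem.Pt V Γ) →
           Sem.⟦ V ⟧ᴰ D w ⇔ (∃[ D′ ] (D′ ⊑ D × Sem.⟦ V ⟧ᴰ D′ w))
lemma6p3 V D w = mk⇔
  (λ (n , x) → truncate n D , truncate-⊑ D n , n , ⟦⟧ₙ-⊆-truncate V D n w x)
  (λ (D′ , D′⊑D , n , x) → n , ⊑⇒⟦⟧ₙ-⊆ V D′⊑D n w x)
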